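{- (Soundness of axiom C7.) Let $\gamma$ be a $\mathcal{PCO}_\sigma$ formula without occurrences of $\Box\!\!\to$. Then for every causal multiteam $T$ of signature $\sigma$, $T\models(\mathbf X=\mathbf x\wedge\gamma)\to(\mathbf X=\mathbf x\,\Box\!\!\to\gamma)$.
   Context: Signature $\sigma=(\mathrm{Dom},\mathrm{Ran})$: finite nonempty set $\mathrm{Dom}$ of variables with a fixed ordering, finite nonempty value sets $\mathrm{Ran}(X)$; $\mathbf W_V$ lists $\mathrm{Dom}\setminus\{V\}$. An assignment $s$ maps each $X$ to $s(X)\in\mathrm{Ran}(X)$. A multiteam is a finite set of assignments, each extended by an extra variable $Key$ (never mentioned in formulas) with pairwise distinct natural values on distinct elements. A causal multiteam $T=(T^-,\mathcal F)$: a multiteam $T^-$ and, for each $V$ in a set $\mathrm{End}(T)\subseteq\mathrm{Dom}$ of endogenous variables, a non-constant $\mathcal F_V:\mathrm{Ran}(\mathbf W_V)\to\mathrm{Ran}(V)$ with $\mathcal F_V(s(\mathbf W_V))=s(V)$ for all $s\in T^-$; the causal graph (arrow $X\to V$ iff $\mathcal F_V$ depends on $X$; $\mathrm{PA}_V$ the set of such $X$) is acyclic. $\mathbf X=\mathbf x$ abbreviates $X_1=x_1\wedge\dots\wedge X_n=x_n$, inconsistent if some variable gets two distinct values. For consistent $\mathbf X=\mathbf x$, $T_{\mathbf X=\mathbf x}=(\{s'\mid s\in T^-\},\mathcal F\upharpoonright(\mathrm{End}(T)\setminus\mathbf X))$ where $s'$ keeps the $Key$ of $s$, $s'(X_i)=x_i$,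 $s'(V)=s(V)$ for exogenous $V\notin\mathbf X$, $s'(V)=\mathcal F_V(s'(\mathrm{PA}_V))$ recursively for endogenous $V\notin\mathbf X$. $\mathcal{CO}_\sigma$: $\alpha::= Y=y\mid Y\neq y\mid\alpha\wedge\alpha\mid\alpha\supset\alpha\mid \mathbf X=\mathbf x\,\Box\!\!\to\alpha$. $\mathcal{PCO}_\sigma$: $\varphi::=\eta\mid\varphi\wedge\varphi\mid\varphi\sqcup\varphi\mid\alpha\supset\varphi\mid\mathbf X=\mathbf x\,\Box\!\!\to\varphi$ with $\alpha\in\mathcal{CO}$ and $\eta$ a literal $Y=y$, $Y\neq y$ or a probabilistic atom $\Pr(\alpha)\geq\epsilon$, $\Pr(\alpha)>\epsilon$, $\Pr(\alpha)\geq\Pr(\beta)$, $\Pr(\alpha)>\Pr(\beta)$ ($\epsilon\in[0,1]\cap\mathbb Q$). Semantics: $T\models Y=y$ iff $s(Y)=y$ for all $s\in T^-$; $T\models Y\neq y$ iff $s(Y)\neq y$ for all $s\in T^-$; $\wedge$ usual; $T\models\psi\sqcup\chi$ iff $T\models\psi$ or $T\models\chi$; $T\models\alpha\supset\psi$ iff $T^\alpha\models\psi$ where $T^\alpha=(\{s\in T^-\mid(\{s\},\mathcal F)\models\alpha\},\mathcal F)$; $T\models\mathbf X=\mathbf x\Box\!\!\to\psi$ iff $\mathbf X=\mathbf x$ inconsistent or $T_{\mathbf X=\mathbf x}\models\psi$; for $\rhd\in\{\geq,>\}$, $T\models\Pr(\alpha)\rhd\epsilon$ iff $T^-=\emptyset$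 or $P_T(\alpha)\rhd\epsilon$, and $T\models\Pr(\alpha)\rhd\Pr(\beta)$ iff $T^-=\emptyset$ or $P_T(\alpha)\rhd P_T(\beta)$, with $P_T(\alpha)=|(T^\alpha)^-|/|T^-|$. Abbreviations: $\top:=X=x\Box\!\!\to X=x$, $\bot:=X=x\Box\!\!\to X\neq x$, $\neg\alpha:=\alpha\supset\bot$; $\Pr(\alpha)\leq\epsilon:=\Pr(\neg\alpha)\geq1-\epsilon$; $\Pr(\alpha)<\epsilon:=\Pr(\neg\alpha)>1-\epsilon$; $\Pr(\alpha)=\epsilon:=\Pr(\alpha)\geq\epsilon\wedge\Pr(\alpha)\leq\epsilon$; $\Pr(\alpha)\neq\epsilon:=\Pr(\alpha)>\epsilon\sqcup\Pr(\alpha)<\epsilon$. Weak contradictory negation $\varphi^C$: $(\Pr(\alpha)\geq\epsilon)^C=\Pr(\alpha)<\epsilon$ and vice versa; $(\Pr(\alpha)>\epsilon)^C=\Pr(\alpha)\leq\epsilon$ and vice versa; $(\Pr(\alpha)=\epsilon)^C=\Pr(\alpha)\neq\epsilon$ and vice versa; $(\Pr(\alpha)\geq\Pr(\beta))^C=\Pr(\beta)>\Pr(\alpha)$ and vice versa; $\bot^C=\top$ and vice versa; $(X=x)^C=\Pr(X=x)<1$; $(X\neq x)^C=\Pr(X\neq x)<1$; $(\psi\wedge\chi)^C=\psi^C\sqcup\chi^C$; $(\psi\sqcup\chi)^C=\psi^C\wedge\chi^C$; $(\alpha\supset\chi)^C=\Pr(\alpha)>0\wedge\alpha\supset\chi^C$;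 $(\mathbf X=\mathbf x\Box\!\!\to\chi)^C=\mathbf X=\mathbf x\Box\!\!\to\chi^C$. $\psi\to\chi:=\psi^C\sqcup\chi$. -}

module Defs where

open import Data.Nat using (ℕ; zero; suc)
open import Data.Fin using (Fin; zero; suc)
import Data.Fin as Fin
open import Data.Bool using (Bool; true; false; _∧_; not; if_then_else_; T)
open import Data.List using (List; []; _∷_; length; map; filterᵇ)
open import Data.List.NonEmpty using (List⁺; _∷_; toList)
open import Data.List.Relation.Unary.All using (All)
open import Data.Product using (Σ; _,_; _×_; ∃₂)
open import Data.Sum using (_⊎_)
open import Data.Maybe using (Maybe; just; nothing)
open import Data.Unit using (⊤)
open import Data.Rational using (ℚ; _≤_; _<_; 0ℚ; 1ℚ; _-_; _/_)
open import Data.Integer using (+_)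
open import Relation.Binary.PropositionalEquality using (_≡_; _≢_; refl)
open import Relation.Nullary using (yes; no; ¬_; does)

-- Signatures: Dom = Fin (suc m) (nonempty, ordered by Fin),
-- Ran(X) = Fin (suc (r X)) (nonempty, finite).

record Sig : Set where
  field
    m : ℕ
    r : Fin (suc m) → ℕ

module _ (σ : Sig) where
  open Sig σ

  Var : Set
  Var = Fin (suc m)

  Val : Var → Set
  Val X = Fin (suc (r X))

  Assignment : Set
  Assignment = (X : Var) → Val X

  Binding : Set
  Binding = Σ Var Val

  -- X = x  (a nonempty tuple of equations X₁ = x₁ ∧ … ∧ Xₙ = xₙ)
  Interv : Set
  Interv = List⁺ Binding

  data CO : Set where
    _≐ᶜ_  : (Y : Var) → Val Y → CO
    _≠ᶜ_  : (Y : Var) → Val Y → CO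
    _∧ᶜ_  : CO → CO → CO
    _⊃ᶜ_  : CO → CO → CO
    _□→ᶜ_ : Interv → CO → CO

  -- PCO formulas (ε ∈ ℚ; the range [0,1] is imposed by the predicate EpsOK)
  data PCO : Set where
    _≐_    : (Y : Var) → Val Y → PCO
    _≠_    : (Y : Var) → Val Y → PCO
    Pr≥    : CO → ℚ → PCO
    Pr>    : CO → ℚ → PCO
    Pr≥Pr  : CO → CO → PCO
    Pr>Pr  : CO → CO → PCO
    _⋀_    : PCO → PCO → PCO
    _⊔_    : PCO → PCO → PCO
    _⊃_    : CO → PCO → PCO
    _□→_   : Interv → PCO → PCO

  -- The multiteam is a list of assignments;
  -- the position in the list plays the role of the Key.  F V is meaningful
  -- only for endogenous V (End V ≡ true); it is a function of the whole
  -- assignment, required (IsCausalMultiteam) not to depend on V itself,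
  -- i.e. it is a function on Ran(W_V).
  record CM : Set where
    field
      team : List Assignment
      End  : Var → Bool
      F    : (V : Var) → Assignment → Val V

module _ {σ : Sig} where
  open Sig σ
  open CM

  DependsOn : CM σ → Var σ → Var σ → Set
  DependsOn M V X = ∃₂ λ (s t : Assignment σ) →
    (∀ Z → Z ≢ X → s Z ≡ t Z) × (F M V s ≢ F M V t)

  Edge : CM σ → Var σ → Var σ → Set
  Edge M X V = T (End M V) × DependsOn M V X

  data Path (M : CM σ) : Var σ → Var σ → Set where
    one  : ∀ {X V} → Edge M X V → Path M X V
    step : ∀ {X Y V} → Edge M X Y → Path M Y V → Path M X V

  Acyclic : CM σ → Set
  Acyclic M = ∀ V → ¬ Path M V V

  allᵇ : {A : Set} → (A → Bool) → List A → Bool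
  allᵇ p [] = true
  allᵇ p (a ∷ as) = p a ∧ allᵇ p as

  IsCausalMultiteam : CM σ → Set
  IsCausalMultiteam M =
    (∀ V → T (End M V) →
       (∀ (s t : Assignment σ) → (∀ Z → Z ≢ V → s Z ≡ t Z) → F M V s ≡ F M V t)
     × (∃₂ λ (s t : Assignment σ) → F M V s ≢ F M V t)
     × All (λ s → F M V s ≡ s V) (team M))
    × Acyclic M

  lookupB : List (Binding σ) → (V : Var σ) → Maybe (Val σ V)
  lookupB [] V = nothing
  lookupB ((X , x) ∷ bs) V with V Fin.≟ X
  ... | yes refl = just x
  ... | no _ = lookupB bs V

  isBound : List (Binding σ) → Var σ → Bool
  isBound bs V with lookupB bs V
  ... | just _ = true
  ... | nothing = false

  agreesFirst : List (Binding σ) → Binding σ → Bool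
  agreesFirst bs (X , x) with lookupB bs X
  ... | just y = does (x Fin.≟ y)
  ... | nothing = false

  -- X = x is consistent: no variable receives two distinct values
  consistent : Interv σ → Bool
  consistent I = allᵇ (agreesFirst (toList I)) (toList I)

  iterate : {A : Set} → ℕ → (A → A) → A → A
  iterate zero f a = a
  iterate (suc n) f a = iterate n f (f a)

  -- one round of the recursive equations defining s'
  updStep : CM σ → List (Binding σ) → Assignment σ → Assignment σ → Assignment σ
  updStep M bs s t V with lookupB bs V
  ... | just x = x
  ... | nothing = if End M V then F M V t else s V

  -- s' : by acyclicity, |Dom| rounds of the equations reach the unique solution
  intervAssign : CM σ → Interv σ → Assignment σ → Assignment σ
  intervAssign M I s = iterate (suc m) (updStep M (toList I) s) s

  intervene : CM σ → Interv σ → CM σ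
  intervene M I = record
    { team = map (intervAssign M I) (team M)
    ; End  = λ V → End M V ∧ not (isBound (toList I) V)
    ; F    = F M
    }

  -- Semantics of CO (decidable, hence Bool-valued)

  single : CM σ → Assignment σ → CM σ
  single M s = record { team = s ∷ [] ; End = End M ; F = F M }

  mutual
    satC : CM σ → CO σ → Bool
    satC M (Y ≐ᶜ y) = allᵇ (λ s → does (s Y Fin.≟ y)) (team M)
    satC M (Y ≠ᶜ y) = allᵇ (λ s → not (does (s Y Fin.≟ y))) (team M)
    satC M (α ∧ᶜ β) = satC M α ∧ satC M β
    satC M (α ⊃ᶜ β) = satC (restrict M α) β
    satC M (I □→ᶜ β) = if consistent I then satC (intervene M I) β else true

    restrict : CM σ → CO σ → CM σ
    restrict M α = record
      { team = filterᵇ (λ s → satC (single M s) α) (team M)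
      ; End = End M
      ; F = F M
      }

  -- P_T(α) compared with ε / with P_T(β); trivially true on the empty team
  PrGE : CM σ → CO σ → ℚ → Set
  PrGE M α ε with length (team M)
  ... | zero = ⊤
  ... | suc n = ε ≤ ((+ length (team (restrict M α))) / suc n)

  PrGT : CM σ → CO σ → ℚ → Set
  PrGT M α ε with length (team M)
  ... | zero = ⊤
  ... | suc n = ε < ((+ length (team (restrict M α))) / suc n)

  PrGEPr : CM σ → CO σ → CO σ → Set
  PrGEPr M α β with length (team M)
  ... | zero = ⊤
  ... | suc n = ((+ length (team (restrict M β))) / suc n)
                  ≤ ((+ length (team (restrict M α))) / suc n)

  PrGTPr : CM σ → CO σ → CO σ → Set
  PrGTPr M α β with length (team M)
  ... | zero = ⊤
  ... | suc n = ((+ length (team (restrict M β))) / suc n)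
                  < ((+ length (team (restrict M α))) / suc n)

  _⊨_ : CM σ → PCO σ → Set
  M ⊨ (Y ≐ y) = T (satC M (Y ≐ᶜ y))
  M ⊨ (Y ≠ y) = T (satC M (Y ≠ᶜ y))
  M ⊨ Pr≥ α ε = PrGE M α ε
  M ⊨ Pr> α ε = PrGT M α ε
  M ⊨ Pr≥Pr α β = PrGEPr M α β
  M ⊨ Pr>Pr α β = PrGTPr M α β
  M ⊨ (φ ⋀ ψ) = (M ⊨ φ) × (M ⊨ ψ)
  M ⊨ (φ ⊔ ψ) = (M ⊨ φ) ⊎ (M ⊨ ψ)
  M ⊨ (α ⊃ φ) = restrict M α ⊨ φ
  M ⊨ (I □→ φ) = T (not (consistent I)) ⊎ (intervene M I ⊨ φ)

  -- ⊥ := X = x □→ X ≠ x, with X the first variable and x its first value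
  ⊥ᶜ : CO σ
  ⊥ᶜ = ((zero , zero) ∷ []) □→ᶜ (zero ≠ᶜ zero)

  ¬ᶜ : CO σ → CO σ
  ¬ᶜ α = α ⊃ᶜ ⊥ᶜ

  Pr≤ : CO σ → ℚ → PCO σ
  Pr≤ α ε = Pr≥ (¬ᶜ α) (1ℚ - ε)

  Pr< : CO σ → ℚ → PCO σ
  Pr< α ε = Pr> (¬ᶜ α) (1ℚ - ε)

  _ᶜ : PCO σ → PCO σ
  (Y ≐ y) ᶜ = Pr< (Y ≐ᶜ y) 1ℚ
  (Y ≠ y) ᶜ = Pr< (Y ≠ᶜ y) 1ℚ
  Pr≥ α ε ᶜ = Pr< α ε
  Pr> α ε ᶜ = Pr≤ α ε
  Pr≥Pr α β ᶜ = Pr>Pr β α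
  Pr>Pr α β ᶜ = Pr≥Pr β α
  (φ ⋀ ψ) ᶜ = (φ ᶜ) ⊔ (ψ ᶜ)
  (φ ⊔ ψ) ᶜ = (φ ᶜ) ⋀ (ψ ᶜ)
  (α ⊃ φ) ᶜ = Pr> α 0ℚ ⋀ (α ⊃ (φ ᶜ))
  (I □→ φ) ᶜ = I □→ (φ ᶜ)

  _⇒_ : PCO σ → PCO σ → PCO σ
  φ ⇒ ψ = (φ ᶜ) ⊔ ψ

  eqConj' : Binding σ → List (Binding σ) → PCO σ
  eqConj' (X , x) [] = X ≐ x
  eqConj' (X , x) (b ∷ bs) = (X ≐ x) ⋀ eqConj' b bs

  eqConj : Interv σ → PCO σ
  eqConj (b ∷ bs) = eqConj' b bs

  NoBoxᶜ : CO σ → Set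
  NoBoxᶜ (Y ≐ᶜ y) = ⊤
  NoBoxᶜ (Y ≠ᶜ y) = ⊤
  NoBoxᶜ (α ∧ᶜ β) = NoBoxᶜ α × NoBoxᶜ β
  NoBoxᶜ (α ⊃ᶜ β) = NoBoxᶜ α × NoBoxᶜ β
  NoBoxᶜ (I □→ᶜ β) = Data.Empty.⊥
    where import Data.Empty

  NoBox : PCO σ → Set
  NoBox (Y ≐ y) = ⊤
  NoBox (Y ≠ y) = ⊤
  NoBox (Pr≥ α ε) = NoBoxᶜ α
  NoBox (Pr> α ε) = NoBoxᶜ α
  NoBox (Pr≥Pr α β) = NoBoxᶜ α × NoBoxᶜ β
  NoBox (Pr>Pr α β) = NoBoxᶜ α × NoBoxᶜ β
  NoBox (φ ⋀ ψ) = NoBox φ × NoBox ψ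
  NoBox (φ ⊔ ψ) = NoBox φ × NoBox ψ
  NoBox (α ⊃ φ) = NoBoxᶜ α × NoBox φ
  NoBox (I □→ φ) = Data.Empty.⊥
    where import Data.Empty

  EpsOK : PCO σ → Set
  EpsOK (Y ≐ y) = ⊤
  EpsOK (Y ≠ y) = ⊤
  EpsOK (Pr≥ α ε) = (0ℚ ≤ ε) × (ε ≤ 1ℚ)
  EpsOK (Pr> α ε) = (0ℚ ≤ ε) × (ε ≤ 1ℚ)
  EpsOK (Pr≥Pr α β) = ⊤
  EpsOK (Pr>Pr α β) = ⊤
  EpsOK (φ ⋀ ψ) = EpsOK φ × EpsOK ψ
  EpsOK (φ ⊔ ψ) = EpsOK φ × EpsOK ψ
  EpsOK (α ⊃ φ) = EpsOK φ
  EpsOK (I □→ φ) = EpsOK φ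

-- Weak contradictory negation is exhaustive: every causal multiteam satisfies φ or φᶜ, for every
-- φ and every threshold.  So either the antecedent X = x ∧ γ fails, and the implication holds
-- through its negation, or T ⊨ X = x ∧ γ.  In that case every assignment of T already gives X the
-- value x and solves the structural equations, so the intervention changes no assignment; and a
-- formula without □→ only looks at the values of the team, so γ transfers from T to T_{X=x}.
module Submission where

open import Defs
open import Data.Bool using (Bool; true; false; _∧_; not; T)
open import Data.Bool.Properties using (∧-identityʳ)
open import Data.Nat as ℕ using (ℕ; zero; suc; _+_; _<_; z<s)
open import Data.Nat.Properties using (+-suc)
open import Data.Integer as ℤ using (+_)
import Data.Integer.Properties as ℤ
import Data.Fin as Fin
open import Data.List using (List; []; _∷_; length; map; filterᵇ; null)
open import Data.List.NonEmpty using (_∷_; toList)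
open import Data.List.Relation.Unary.All as All using (All; []; _∷_)
open import Data.List.Relation.Binary.Pointwise using (Pointwise; []; _∷_; filter⁺; Pointwise-length)
open import Data.Maybe using (just; nothing)
open import Data.Product using (_,_; proj₁; proj₂)
open import Data.Rational as ℚ using (0ℚ; 1ℚ; _-_; _/_)
import Data.Rational.Properties as ℚ
import Data.Rational.Unnormalised as ℚᵘ
import Data.Rational.Unnormalised.Properties as ℚᵘ
open import Data.Sum using (_⊎_; inj₁; inj₂)
open import Data.Unit using (tt)
open import Function using (_∘_; id)
open import Relation.Binary.PropositionalEquality
open import Relation.Nullary using (yes; no; does)
open import Relation.Nullary.Decidable using (T?)

complementary-fractionsᵘ : ∀ n j k → j + k ≡ suc n →
  ℚᵘ.mkℚᵘ (+ j) n ℚᵘ.+ ℚᵘ.mkℚᵘ (+ k) n ℚᵘ.≃ ℚᵘ.1ℚᵘ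
complementary-fractionsᵘ n j k j+k≡N = ℚᵘ.*≡* (begin
  (+ j ℤ.* + N ℤ.+ + k ℤ.* + N) ℤ.* + 1 ≡⟨ ℤ.*-identityʳ _ ⟩
  + j ℤ.* + N ℤ.+ + k ℤ.* + N          ≡⟨ ℤ.*-distribʳ-+ (+ N) (+ j) (+ k) ⟨
  (+ j ℤ.+ + k) ℤ.* + N                ≡⟨ cong (ℤ._* + N) (trans (sym (ℤ.pos-+ j k)) (cong +_ j+k≡N)) ⟩
  + N ℤ.* + N                          ≡⟨ ℤ.pos-* N N ⟨
  + (N ℕ.* N)                          ≡⟨ ℤ.*-identityˡ _ ⟨
  + 1 ℤ.* + (N ℕ.* N)                  ∎)
  where
  N = suc n
  open ≡-Reasoning

complementary-fractions : ∀ n j k → j + k ≡ suc n → + j / suc n ℚ.+ + k / suc n ≡ 1ℚ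
complementary-fractions n j k j+k≡N = ℚ.toℚᵘ-injective (begin
  ℚ.toℚᵘ (+ j / suc n ℚ.+ + k / suc n)                ≈⟨ ℚ.toℚᵘ-homo-+ (+ j / suc n) (+ k / suc n) ⟩
  ℚ.toℚᵘ (+ j / suc n) ℚᵘ.+ ℚ.toℚᵘ (+ k / suc n)      ≈⟨ ℚᵘ.+-cong (ℚ.toℚᵘ-fromℚᵘ (ℚᵘ.mkℚᵘ (+ j) n))
                                                                  (ℚ.toℚᵘ-fromℚᵘ (ℚᵘ.mkℚᵘ (+ k) n)) ⟩
  ℚᵘ.mkℚᵘ (+ j) n ℚᵘ.+ ℚᵘ.mkℚᵘ (+ k) n                ≈⟨ complementary-fractionsᵘ n j k j+k≡N ⟩
  ℚᵘ.1ℚᵘ                                              ∎)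
  where open ℚᵘ.≃-Reasoning

fraction-complement : ∀ n j k → j + k ≡ suc n → + j / suc n ≡ 1ℚ - + k / suc n
fraction-complement n j k j+k≡N = begin
  p                  ≡⟨ ℚ.+-identityʳ p ⟨
  p ℚ.+ 0ℚ           ≡⟨ cong (p ℚ.+_) (ℚ.+-inverseʳ q) ⟨
  p ℚ.+ (q - q)      ≡⟨ ℚ.+-assoc p q (ℚ.- q) ⟨
  (p ℚ.+ q) - q      ≡⟨ cong (_- q) (complementary-fractions n j k j+k≡N) ⟩
  1ℚ - q             ∎
  where
  p = + j / suc n
  q = + k / suc n
  open ≡-Reasoning

≤-or-complement-> : ∀ n j k → j + k ≡ suc n → ∀ ε →
  ε ℚ.≤ + k / suc n ⊎ 1ℚ - ε ℚ.< + j / suc n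
≤-or-complement-> n j k j+k≡N ε with ε ℚ.≤? + k / suc n
... | yes ε≤q = inj₁ ε≤q
... | no ε≰q = inj₂ (subst (1ℚ - ε ℚ.<_) (sym (fraction-complement n j k j+k≡N))
                      (ℚ.+-monoʳ-< 1ℚ (ℚ.neg-antimono-< (ℚ.≰⇒> ε≰q))))

<-or-complement-≤ : ∀ n j k → j + k ≡ suc n → ∀ ε →
  ε ℚ.< + k / suc n ⊎ 1ℚ - ε ℚ.≤ + j / suc n
<-or-complement-≤ n j k j+k≡N ε with ε ℚ.<? + k / suc n
... | yes ε<q = inj₁ ε<q
... | no ε≮q = inj₂ (subst (1ℚ - ε ℚ.≤_) (sym (fraction-complement n j k j+k≡N))
                      (ℚ.+-monoʳ-≤ 1ℚ (ℚ.neg-antimono-≤ (ℚ.≮⇒≥ ε≮q))))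

≤-or-> : ∀ p q → p ℚ.≤ q ⊎ q ℚ.< p
≤-or-> p q with p ℚ.≤? q
... | yes p≤q = inj₁ p≤q
... | no p≰q = inj₂ (ℚ.≰⇒> p≰q)

<-or-≥ : ∀ p q → p ℚ.< q ⊎ q ℚ.≤ p
<-or-≥ p q with p ℚ.<? q
... | yes p<q = inj₁ p<q
... | no p≮q = inj₂ (ℚ.≮⇒≥ p≮q)

module _ {A : Set} where

  filterᵇ-cong : {p q : A → Bool} → (∀ a → p a ≡ q a) → ∀ xs → filterᵇ p xs ≡ filterᵇ q xs
  filterᵇ-cong p≗q [] = refl
  filterᵇ-cong {q = q} p≗q (x ∷ xs) rewrite p≗q x with q x
  ... | true = cong (x ∷_) (filterᵇ-cong p≗q xs)
  ... | false = filterᵇ-cong p≗q xs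

  length-filterᵇ-not : (p : A → Bool) → ∀ xs →
    length (filterᵇ (not ∘ p) xs) + length (filterᵇ p xs) ≡ length xs
  length-filterᵇ-not p [] = refl
  length-filterᵇ-not p (x ∷ xs) with p x
  ... | true = trans (+-suc _ _) (cong suc (length-filterᵇ-not p xs))
  ... | false = cong suc (length-filterᵇ-not p xs)

  null-filterᵇ-[x] : (p : A → Bool) (x : A) → null (filterᵇ p (x ∷ [])) ≡ not (p x)
  null-filterᵇ-[x] p x with p x
  ... | true = refl
  ... | false = refl

  filterᵇ-pointwise : {R : A → A → Set} {p q : A → Bool} → (∀ {a b} → R a b → p a ≡ q b) →
    ∀ {xs ys} → Pointwise R xs ys → Pointwise R (filterᵇ p xs) (filterᵇ q ys)
  filterᵇ-pointwise p≈q = filter⁺ (T? ∘ _) (T? ∘ _) (λ r → subst T (p≈q r)) (λ r → subst T (sym (p≈q r)))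

module _ {σ : Sig} where
  open CM

  module _ {A : Set} (p : A → Bool) where

    0<length-filterᵇ-not : ∀ xs → allᵇ {σ = σ} p xs ≡ false → 0 < length (filterᵇ (not ∘ p) xs)
    0<length-filterᵇ-not (x ∷ xs) all≡false with p x
    ... | true = 0<length-filterᵇ-not xs all≡false
    ... | false = z<s

    T-allᵇ⇒All : ∀ xs → T (allᵇ {σ = σ} p xs) → All (T ∘ p) xs
    T-allᵇ⇒All [] _ = []
    T-allᵇ⇒All (x ∷ xs) all-p with p x in px
    ... | true = subst T (sym px) tt ∷ T-allᵇ⇒All xs all-p

    allᵇ-pointwise : {R : A → A → Set} → (∀ {a b} → R a b → p a ≡ p b) →
      ∀ {xs ys} → Pointwise R xs ys → allᵇ {σ = σ} p xs ≡ allᵇ {σ = σ} p ys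
    allᵇ-pointwise p-resp [] = refl
    allᵇ-pointwise p-resp (r ∷ rs) = cong₂ _∧_ (p-resp r) (allᵇ-pointwise p-resp rs)

  _≗ₐ_ : Assignment σ → Assignment σ → Set
  s ≗ₐ t = ∀ X → s X ≡ t X

  _≈ₜ_ : CM σ → CM σ → Set
  M ≈ₜ M' = Pointwise _≗ₐ_ (team M) (team M')

  holdsAt : CM σ → CO σ → Assignment σ → Bool
  holdsAt M α s = satC (single M s) α

  count : CM σ → CO σ → ℕ
  count M α = length (team (restrict M α))

  iterate-suc : {A : Set} (n : ℕ) (f : A → A) (a : A) →
    iterate {σ = σ} (suc n) f a ≡ f (iterate {σ = σ} n f a)
  iterate-suc zero f a = refl
  iterate-suc (suc n) f a = iterate-suc n f (f a)

  updStep-bound : ∀ M bs (s t : Assignment σ) {V x} → lookupB bs V ≡ just x → updStep M bs s t V ≡ x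
  updStep-bound M bs s t {V} bound with lookupB bs V | bound
  ... | just x | refl = refl

  intervAssign-bound : ∀ M I s {V x} → lookupB (toList I) V ≡ just x → intervAssign M I s V ≡ x
  intervAssign-bound M I s {V} bound = trans
    (cong (λ (t : Assignment σ) → t V) (iterate-suc (Sig.m σ) f s))
    (updStep-bound M (toList I) s (iterate {σ = σ} (Sig.m σ) f s) bound)
    where f = updStep M (toList I) s

  -- ⊥ᶜ intervenes on the first variable and then asks it to differ from its new value.
  satC-⊥ᶜ : ∀ R → satC R ⊥ᶜ ≡ null (team R)
  satC-⊥ᶜ R with team R
  ... | [] = refl
  ... | s ∷ _ rewrite intervAssign-bound R ((Fin.zero , Fin.zero) ∷ []) s {Fin.zero} refl = refl

  holdsAt-¬ᶜ : ∀ M α s → holdsAt M (¬ᶜ α) s ≡ not (holdsAt M α s)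
  holdsAt-¬ᶜ M α s = trans (satC-⊥ᶜ (restrict (single M s) α)) (null-filterᵇ-[x] (holdsAt M α) s)

  count-¬ᶜ : ∀ M α → count M (¬ᶜ α) ≡ length (filterᵇ (not ∘ holdsAt M α) (team M))
  count-¬ᶜ M α = cong length (filterᵇ-cong (holdsAt-¬ᶜ M α) (team M))

  count-complement : ∀ M α → count M (¬ᶜ α) + count M α ≡ length (team M)
  count-complement M α = trans (cong (_+ count M α) (count-¬ᶜ M α))
                               (length-filterᵇ-not (holdsAt M α) (team M))

  PrGT-positive : ∀ M α → 0 < count M α → PrGT M α 0ℚ
  PrGT-positive M α 0<k with length (team M)
  ... | zero = tt
  ... | suc n = ℚ.positive⁻¹ _ {{ℚ.normalize-pos (count M α) (suc n) {{_}} {{ℕ.>-nonZero 0<k}}}}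

  ⊨-empty : ∀ M φ → team M ≡ [] → M ⊨ φ
  ⊨-empty M (Y ≐ y) empty rewrite empty = tt
  ⊨-empty M (Y ≠ y) empty rewrite empty = tt
  ⊨-empty M (Pr≥ α ε) empty with length (team M) | cong length empty
  ... | zero | _ = tt
  ⊨-empty M (Pr> α ε) empty with length (team M) | cong length empty
  ... | zero | _ = tt
  ⊨-empty M (Pr≥Pr α β) empty with length (team M) | cong length empty
  ... | zero | _ = tt
  ⊨-empty M (Pr>Pr α β) empty with length (team M) | cong length empty
  ... | zero | _ = tt
  ⊨-empty M (φ ⋀ ψ) empty = ⊨-empty M φ empty , ⊨-empty M ψ empty
  ⊨-empty M (φ ⊔ ψ) empty = inj₁ (⊨-empty M φ empty)
  ⊨-empty M (α ⊃ φ) empty = ⊨-empty (restrict M α) φ (cong (filterᵇ (holdsAt M α)) empty)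
  ⊨-empty M (I □→ φ) empty = inj₂ (⊨-empty (intervene M I) φ (cong (map (intervAssign M I)) empty))

  -- Covers the literals: (Y = y)ᶜ is Pr(¬ (Y = y)) > 1 - 1, and 1ℚ - 1ℚ computes to 0ℚ.
  literal-dichotomy : ∀ M α (p : Assignment σ → Bool) → satC M α ≡ allᵇ {σ = σ} p (team M) →
    (∀ s → holdsAt M α s ≡ p s) → T (satC M α) ⊎ PrGT M (¬ᶜ α) 0ℚ
  literal-dichotomy M α p sat≡all holds≡p with satC M α | sat≡all
  ... | true | _ = inj₁ tt
  ... | false | false≡all = inj₂ (PrGT-positive M (¬ᶜ α)
        (subst (0 <_) (sym count≡) (0<length-filterᵇ-not p (team M) (sym false≡all))))
    where
    count≡ : count M (¬ᶜ α) ≡ length (filterᵇ (not ∘ p) (team M))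
    count≡ = trans (count-¬ᶜ M α) (cong length (filterᵇ-cong (cong not ∘ holds≡p) (team M)))

  ⊨-dichotomy : ∀ M φ → (M ⊨ φ) ⊎ (M ⊨ (φ ᶜ))
  ⊨-dichotomy M (Y ≐ y) = literal-dichotomy M (Y ≐ᶜ y) _ refl (λ _ → ∧-identityʳ _)
  ⊨-dichotomy M (Y ≠ y) = literal-dichotomy M (Y ≠ᶜ y) _ refl (λ _ → ∧-identityʳ _)
  ⊨-dichotomy M (Pr≥ α ε) with length (team M) | count-complement M α
  ... | zero | _ = inj₁ tt
  ... | suc n | j+k≡N = ≤-or-complement-> n (count M (¬ᶜ α)) (count M α) j+k≡N ε
  ⊨-dichotomy M (Pr> α ε) with length (team M) | count-complement M α
  ... | zero | _ = inj₁ tt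
  ... | suc n | j+k≡N = <-or-complement-≤ n (count M (¬ᶜ α)) (count M α) j+k≡N ε
  ⊨-dichotomy M (Pr≥Pr α β) with length (team M)
  ... | zero = inj₁ tt
  ... | suc n = ≤-or-> (+ count M β / suc n) (+ count M α / suc n)
  ⊨-dichotomy M (Pr>Pr α β) with length (team M)
  ... | zero = inj₁ tt
  ... | suc n = <-or-≥ (+ count M β / suc n) (+ count M α / suc n)
  ⊨-dichotomy M (φ ⋀ ψ) with ⊨-dichotomy M φ | ⊨-dichotomy M ψ
  ... | inj₁ φ-holds | inj₁ ψ-holds = inj₁ (φ-holds , ψ-holds)
  ... | inj₂ φᶜ-holds | _ = inj₂ (inj₁ φᶜ-holds)
  ... | inj₁ _ | inj₂ ψᶜ-holds = inj₂ (inj₂ ψᶜ-holds)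
  ⊨-dichotomy M (φ ⊔ ψ) with ⊨-dichotomy M φ | ⊨-dichotomy M ψ
  ... | inj₁ φ-holds | _ = inj₁ (inj₁ φ-holds)
  ... | inj₂ _ | inj₁ ψ-holds = inj₁ (inj₂ ψ-holds)
  ... | inj₂ φᶜ-holds | inj₂ ψᶜ-holds = inj₂ (φᶜ-holds , ψᶜ-holds)
  ⊨-dichotomy M (α ⊃ φ) with team (restrict M α) in restricted
  ... | [] = inj₁ (⊨-empty (restrict M α) φ restricted)
  ... | _ ∷ _ with ⊨-dichotomy (restrict M α) φ
  ...   | inj₁ φ-holds = inj₁ φ-holds
  ...   | inj₂ φᶜ-holds = inj₂ (PrGT-positive M α (subst (0 <_) (sym (cong length restricted)) z<s) , φᶜ-holds)
  ⊨-dichotomy M (I □→ φ) with consistent I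
  ... | false = inj₁ (inj₁ tt)
  ... | true with ⊨-dichotomy (intervene M I) φ
  ...   | inj₁ φ-holds = inj₁ (inj₂ φ-holds)
  ...   | inj₂ φᶜ-holds = inj₂ (inj₂ φᶜ-holds)

  mutual
    satC-≈ : ∀ {M M'} α → NoBoxᶜ α → M ≈ₜ M' → satC M α ≡ satC M' α
    satC-≈ (Y ≐ᶜ y) _ M≈M' = allᵇ-pointwise _ (λ s≗t → cong (λ v → does (v Fin.≟ y)) (s≗t Y)) M≈M'
    satC-≈ (Y ≠ᶜ y) _ M≈M' = allᵇ-pointwise _ (λ s≗t → cong (λ v → not (does (v Fin.≟ y))) (s≗t Y)) M≈M'
    satC-≈ (α ∧ᶜ β) (α-nb , β-nb) M≈M' = cong₂ _∧_ (satC-≈ α α-nb M≈M') (satC-≈ β β-nb M≈M')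
    satC-≈ (α ⊃ᶜ β) (α-nb , β-nb) M≈M' = satC-≈ β β-nb (restrict-≈ α α-nb M≈M')

    restrict-≈ : ∀ {M M'} α → NoBoxᶜ α → M ≈ₜ M' → restrict M α ≈ₜ restrict M' α
    restrict-≈ α α-nb = filterᵇ-pointwise (λ s≗t → satC-≈ α α-nb (s≗t ∷ []))

  count-≈ : ∀ {M M'} α → NoBoxᶜ α → M ≈ₜ M' → count M α ≡ count M' α
  count-≈ α α-nb M≈M' = Pointwise-length (restrict-≈ α α-nb M≈M')

  PrGE-≈ : ∀ {M M'} α ε → NoBoxᶜ α → M ≈ₜ M' → PrGE M α ε → PrGE M' α ε
  PrGE-≈ {M} {M'} α ε α-nb M≈M'
    with length (team M) | length (team M') | Pointwise-length M≈M' | count-≈ α α-nb M≈M'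
  ... | zero | _ | refl | _ = id
  ... | suc n | _ | refl | k≡k' = subst (λ k → ε ℚ.≤ + k / suc n) k≡k'

  PrGT-≈ : ∀ {M M'} α ε → NoBoxᶜ α → M ≈ₜ M' → PrGT M α ε → PrGT M' α ε
  PrGT-≈ {M} {M'} α ε α-nb M≈M'
    with length (team M) | length (team M') | Pointwise-length M≈M' | count-≈ α α-nb M≈M'
  ... | zero | _ | refl | _ = id
  ... | suc n | _ | refl | k≡k' = subst (λ k → ε ℚ.< + k / suc n) k≡k'

  PrGEPr-≈ : ∀ {M M'} α β → NoBoxᶜ α → NoBoxᶜ β → M ≈ₜ M' → PrGEPr M α β → PrGEPr M' α β
  PrGEPr-≈ {M} {M'} α β α-nb β-nb M≈M'
    with length (team M) | length (team M') | Pointwise-length M≈M'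
  ... | zero | _ | refl = id
  ... | suc n | _ | refl = subst₂ (λ a b → + b / suc n ℚ.≤ + a / suc n)
                                  (count-≈ α α-nb M≈M') (count-≈ β β-nb M≈M')

  PrGTPr-≈ : ∀ {M M'} α β → NoBoxᶜ α → NoBoxᶜ β → M ≈ₜ M' → PrGTPr M α β → PrGTPr M' α β
  PrGTPr-≈ {M} {M'} α β α-nb β-nb M≈M'
    with length (team M) | length (team M') | Pointwise-length M≈M'
  ... | zero | _ | refl = id
  ... | suc n | _ | refl = subst₂ (λ a b → + b / suc n ℚ.< + a / suc n)
                                  (count-≈ α α-nb M≈M') (count-≈ β β-nb M≈M')

  ⊨-≈ : ∀ {M M'} φ → NoBox φ → M ≈ₜ M' → M ⊨ φ → M' ⊨ φ
  ⊨-≈ {M} {M'} (Y ≐ y) _ M≈M' = subst T (satC-≈ {M} {M'} (Y ≐ᶜ y) tt M≈M')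
  ⊨-≈ {M} {M'} (Y ≠ y) _ M≈M' = subst T (satC-≈ {M} {M'} (Y ≠ᶜ y) tt M≈M')
  ⊨-≈ (Pr≥ α ε) α-nb = PrGE-≈ α ε α-nb
  ⊨-≈ (Pr> α ε) α-nb = PrGT-≈ α ε α-nb
  ⊨-≈ (Pr≥Pr α β) (α-nb , β-nb) = PrGEPr-≈ α β α-nb β-nb
  ⊨-≈ (Pr>Pr α β) (α-nb , β-nb) = PrGTPr-≈ α β α-nb β-nb
  ⊨-≈ (φ ⋀ ψ) (φ-nb , ψ-nb) M≈M' (φ-holds , ψ-holds) = ⊨-≈ φ φ-nb M≈M' φ-holds , ⊨-≈ ψ ψ-nb M≈M' ψ-holds
  ⊨-≈ (φ ⊔ ψ) (φ-nb , _) M≈M' (inj₁ φ-holds) = inj₁ (⊨-≈ φ φ-nb M≈M' φ-holds)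
  ⊨-≈ (φ ⊔ ψ) (_ , ψ-nb) M≈M' (inj₂ ψ-holds) = inj₂ (⊨-≈ ψ ψ-nb M≈M' ψ-holds)
  ⊨-≈ (α ⊃ φ) (α-nb , φ-nb) M≈M' = ⊨-≈ φ φ-nb (restrict-≈ α α-nb M≈M')

  Agrees : Assignment σ → Binding σ → Set
  Agrees s (X , x) = s X ≡ x

  T-does-≟ : ∀ {X} {a b : Val σ X} → T (does (a Fin.≟ b)) → a ≡ b
  T-does-≟ {a = a} {b} a≟b with a Fin.≟ b
  ... | yes a≡b = a≡b

  eqConj-agrees : ∀ M b bs → M ⊨ eqConj' b bs → All (λ s → All (Agrees s) (b ∷ bs)) (team M)
  eqConj-agrees M (X , x) [] X≐x =
    All.map (λ X≐x-at-s → T-does-≟ X≐x-at-s ∷ []) (T-allᵇ⇒All _ (team M) X≐x)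
  eqConj-agrees M (X , x) (b ∷ bs) (X≐x , rest) =
    All.zipWith (λ (X≐x-at-s , rest-at-s) → T-does-≟ X≐x-at-s ∷ rest-at-s)
                (T-allᵇ⇒All _ (team M) X≐x , eqConj-agrees M b bs rest)

  lookupB-agrees : ∀ {s bs V x} → All (Agrees s) bs → lookupB bs V ≡ just x → s V ≡ x
  lookupB-agrees {bs = (X , _) ∷ _} {V} (s-agrees ∷ agreements) bound with V Fin.≟ X | bound
  ... | yes refl | refl = s-agrees
  ... | no _ | bound′ = lookupB-agrees agreements bound′

  F-respects-≗ₐ : ∀ {M : CM σ} → IsCausalMultiteam M → ∀ V → T (End M V) →
    ∀ {t s} → t ≗ₐ s → F M V t ≡ F M V s
  F-respects-≗ₐ cm V V-end t≗s = proj₁ (proj₁ cm V V-end) _ _ (λ Z _ → t≗s Z)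

  team-solves-F : ∀ {M : CM σ} → IsCausalMultiteam M → ∀ V → T (End M V) → All (λ s → F M V s ≡ s V) (team M)
  team-solves-F cm V V-end = proj₂ (proj₂ (proj₁ cm V V-end))

  module _ (M : CM σ) (F-resp : ∀ V → T (End M V) → ∀ {t s} → t ≗ₐ s → F M V t ≡ F M V s)
           (bs : List (Binding σ)) (s : Assignment σ)
           (agreements : All (Agrees s) bs) (solves : ∀ V → T (End M V) → F M V s ≡ s V) where

    updStep-fixes : ∀ t → t ≗ₐ s → updStep M bs s t ≗ₐ s
    updStep-fixes t t≗s V with lookupB bs V in bound
    ... | just x = sym (lookupB-agrees agreements bound)
    ... | nothing with End M V in endogenous
    ...   | true = trans (F-resp V V-end t≗s) (solves V V-end)
      where V-end = subst T (sym endogenous) tt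
    ...   | false = refl

    iterate-updStep-fixes : ∀ k t → t ≗ₐ s → iterate {σ = σ} k (updStep M bs s) t ≗ₐ s
    iterate-updStep-fixes zero t t≗s = t≗s
    iterate-updStep-fixes (suc k) t t≗s = iterate-updStep-fixes k (updStep M bs s t) (updStep-fixes t t≗s)

  intervAssign-fixes : ∀ {M : CM σ} I s → IsCausalMultiteam M → All (Agrees s) (toList I) →
    (∀ V → T (End M V) → F M V s ≡ s V) → s ≗ₐ intervAssign M I s
  intervAssign-fixes {M} I s cm agreements solves V =
    sym (iterate-updStep-fixes M (F-respects-≗ₐ cm) (toList I) s agreements solves (suc (Sig.m σ)) s (λ _ → refl) V)

  intervene-≈ : ∀ {M : CM σ} I → IsCausalMultiteam M →
    All (λ s → All (Agrees s) (toList I)) (team M) → M ≈ₜ intervene M I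
  intervene-≈ {M} I cm agreements = fixes (team M) agreements (team-solves-F cm)
    where
    fixes : ∀ xs → All (λ s → All (Agrees s) (toList I)) xs →
      (∀ V → T (End M V) → All (λ s → F M V s ≡ s V) xs) →
      Pointwise _≗ₐ_ xs (map (intervAssign M I) xs)
    fixes [] [] _ = []
    fixes (s ∷ xs) (s-agrees ∷ agreements) solved =
      intervAssign-fixes I s cm s-agrees (λ V V-end → All.head (solved V V-end))
      ∷ fixes xs agreements (λ V V-end → All.tail (solved V V-end))

mainTheorem8 : (σ : Sig) (γ : PCO σ) → NoBox γ → EpsOK γ →
    (I : Interv σ) (M : CM σ) → IsCausalMultiteam M →
    M ⊨ ((eqConj I ⋀ γ) ⇒ (I □→ γ))
mainTheorem8 σ γ γ-nb _ I@(b ∷ bs) M cm with ⊨-dichotomy M (eqConj I) | ⊨-dichotomy M γ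
... | inj₂ eqConjᶜ-holds | _ = inj₁ (inj₁ eqConjᶜ-holds)
... | inj₁ _ | inj₂ γᶜ-holds = inj₁ (inj₂ γᶜ-holds)
... | inj₁ eqConj-holds | inj₁ γ-holds =
  inj₂ (inj₂ (⊨-≈ γ γ-nb (intervene-≈ I cm (eqConj-agrees M b bs eqConj-holds)) γ-holds))
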